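{- Let $G$ be a Cameron group with $(A_m^{(k)})^d\le G\le S_m^{(k)}\wr S_d$, acting on $n=\binom{m}{k}^d$ points, where $k\le m/2$. Then, as $m\to\infty$, uniformly in $d$: $\mathrm{mindeg}(G)=o(n)$ if and only if $k=o(m)$. Precisely: for any sequence of such data $(m_j,k_j,d_j,G_j)_{j\ge1}$ with $m_j\to\infty$ (and $d_j$ arbitrary), writing $n_j=\binom{m_j}{k_j}^{d_j}$, we have $\mathrm{mindeg}(G_j)/n_j\to0$ if and only if $k_j/m_j\to0$.
   Context: $S_m^{(k)}$ (resp. $A_m^{(k)}$) denotes the symmetric (resp. alternating) group of degree $m$ acting on the $k$-element subsets of an $m$-set. $S_m^{(k)}\wr S_d$ acts on $d$-tuples of $k$-subsets by the product action: the base group acts coordinatewise and $S_d$ permutes coordinates; $(A_m^{(k)})^d$ is the subgroup of the base group with all components in $A_m^{(k)}$. A Cameron group is a primitive permutation group $G$ with $(A_m^{(k)})^d\le G\le S_m^{(k)}\wr S_d$. The minimal degree $\mathrm{mindeg}(G)$ of a permutation group $G$ on $\Omega$ is the minimum number of points moved by a non-identity element of $G$ ($|\Omega|$ if $G$ is trivial). -}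

module Defs where

open import Level using (0ℓ)
open import Data.Bool using (Bool)
import Data.Bool.Properties as BoolP
open import Data.Nat as ℕ using (ℕ; zero; suc; _+_; _*_; _≤_; _<_; _^_)
import Data.Nat.Properties as ℕP
open import Data.Nat.Divisibility using (_∣_)
open import Data.Nat.Combinatorics using (_C_)
open import Data.Fin using (Fin)
import Data.Fin as Fin
open import Data.Fin.Subset using (Subset; ∣_∣)
open import Data.Fin.Permutation using (Permutation′; _⟨$⟩ʳ_; _⟨$⟩ˡ_; _∘ₚ_; flip; _≈_)
import Data.Fin.Permutation as Perm
open import Data.Vec as Vec using (Vec; []; _∷_; lookup; tabulate)
import Data.Vec.Properties as VecP
open import Data.Vec.Relation.Unary.All using (All)
open import Data.List as List using (List; length; filter; allFin; concatMap)
open import Data.Product using (Σ; _×_; _,_; ∃)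
open import Data.Sum using (_⊎_)
open import Data.Integer using (+_)
open import Data.Rational as ℚ using (ℚ; 0ℚ)
open import Relation.Nullary using (¬_; ¬?)
open import Relation.Binary.PropositionalEquality using (_≡_; _≢_)
open import Relation.Unary using (Pred; _∈_)

inversions : ∀ {m} → Permutation′ m → ℕ
inversions {m} σ =
  length (filter (λ p → (σ ⟨$⟩ʳ Data.Product.proj₂ p) Fin.<? (σ ⟨$⟩ʳ Data.Product.proj₁ p))
    (filter (λ p → Data.Product.proj₁ p Fin.<? Data.Product.proj₂ p)
      (List.cartesianProduct (allFin m) (allFin m))))

IsEven : ∀ {m} → Permutation′ m → Set
IsEven σ = 2 ∣ inversions σ

-- The wreath product  S_m ≀ S_d  (elements: (σ₁,…,σ_d ; π))

W : ℕ → ℕ → Set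
W m d = (Fin d → Permutation′ m) × Permutation′ d

_≈W_ : ∀ {m d} → W m d → W m d → Set
(σ , π) ≈W (τ , ρ) = (∀ i → σ i ≈ τ i) × (π ≈ ρ)

-- identity, product (g·h acts as "first h, then g"), inverse
oneW : ∀ {m d} → W m d
oneW = (λ _ → Perm.id) , Perm.id

mulW : ∀ {m d} → W m d → W m d → W m d
mulW (σ , π) (τ , ρ) = (λ i → τ (π ⟨$⟩ˡ i) ∘ₚ σ i) , (ρ ∘ₚ π)

invW : ∀ {m d} → W m d → W m d
invW (σ , π) = (λ i → flip (σ (π ⟨$⟩ʳ i))) , flip π

actS : ∀ {m} → Permutation′ m → Subset m → Subset m
actS σ s = tabulate (λ j → lookup s (σ ⟨$⟩ˡ j))

Tuple : ℕ → ℕ → Set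
Tuple m d = Vec (Subset m) d

act : ∀ {m d} → W m d → Tuple m d → Tuple m d
act (σ , π) x = tabulate (λ i → actS (σ i) (lookup x (π ⟨$⟩ˡ i)))

IsPt : ∀ {m d} → ℕ → Tuple m d → Set
IsPt k x = All (λ s → ∣ s ∣ ≡ k) x

_≟T_ : ∀ {m d} → (x y : Tuple m d) → Relation.Nullary.Dec (x ≡ y)
_≟T_ = VecP.≡-dec (VecP.≡-dec BoolP._≟_)

allSubsets : ∀ m → List (Subset m)
allSubsets zero    = [] List.∷ List.[]
allSubsets (suc m) = concatMap (λ s → (Bool.true ∷ s) List.∷ (Bool.false ∷ s) List.∷ List.[]) (allSubsets m)

allTuples : ∀ m d → List (Tuple m d)
allTuples m zero    = [] List.∷ List.[]
allTuples m (suc d) = concatMap (λ s → List.map (s ∷_) (allTuples m d)) (allSubsets m)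

Ω : ∀ m k d → List (Tuple m d)
Ω m k d = filter (λ x → Data.Vec.Relation.Unary.All.all? (λ s → ∣ s ∣ ℕ.≟ k) x) (allTuples m d)

moved : ∀ {m d} → ℕ → W m d → ℕ
moved {m} {d} k g = length (filter (λ x → ¬? (act g x ≟T x)) (Ω m k d))

NonId : ∀ {m d} → ℕ → W m d → Set
NonId k g = ∃ λ x → IsPt k x × act g x ≢ x

IsSubgroup : ∀ {m d} → Pred (W m d) 0ℓ → Set
IsSubgroup G =
  (∀ {g h} → g ≈W h → g ∈ G → h ∈ G) ×
  (oneW ∈ G) ×
  (∀ {g h} → g ∈ G → h ∈ G → mulW g h ∈ G) ×
  (∀ {g} → g ∈ G → invW g ∈ G)

IsTransitive : ∀ {m d} → ℕ → Pred (W m d) 0ℓ → Set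
IsTransitive k G = ∀ x y → IsPt k x → IsPt k y → ∃ λ g → g ∈ G × act g x ≡ y

_∈B_ : ∀ {m d} → Tuple m d → (Tuple m d → Bool) → Set
x ∈B B = B x ≡ Bool.true

IsBlock : ∀ {m d} → ℕ → Pred (W m d) 0ℓ → (Tuple m d → Bool) → Set
IsBlock k G B =
  (∀ x → x ∈B B → IsPt k x) ×
  (∀ g → g ∈ G →
     ((∀ x → x ∈B B → act g x ∈B B) × (∀ x → act g x ∈B B → x ∈B B))
     ⊎ (∀ x → x ∈B B → ¬ (act g x ∈B B)))

IsTrivialBlock : ∀ {m d} → ℕ → (Tuple m d → Bool) → Set
IsTrivialBlock k B = (∀ x y → x ∈B B → y ∈B B → x ≡ y) ⊎ (∀ x → IsPt k x → x ∈B B)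

IsPrimitive : ∀ {m d} → ℕ → Pred (W m d) 0ℓ → Set
IsPrimitive k G = IsTransitive k G × (∀ B → IsBlock k G B → IsTrivialBlock k B)

IsCameron : ∀ m k d → Pred (W m d) 0ℓ → Set
IsCameron m k d G =
  IsSubgroup G ×
  (∀ (σ : Fin d → Permutation′ m) → (∀ i → IsEven (σ i)) → (σ , Perm.id) ∈ G) ×
  IsPrimitive k G

IsMinDeg : ∀ m k d → Pred (W m d) 0ℓ → ℕ → Set
IsMinDeg m k d G D =
  (∃ λ g → g ∈ G × NonId k g × moved k g ≡ D ×
     (∀ h → h ∈ G → NonId k h → D ≤ moved k h))
  ⊎ ((∀ h → h ∈ G → ¬ NonId k h) × D ≡ length (Ω m k d))

ratio : ℕ → ℕ → ℚ
ratio a zero    = 0ℚ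
ratio a (suc b) = (+ a) ℚ./ suc b

TendsToZero : (ℕ → ℚ) → Set
TendsToZero x = ∀ (ε : ℚ) → 0ℚ ℚ.< ε → ∃ λ N → ∀ j → N ≤ j → ℚ.∣ x j ∣ ℚ.< ε

TendsToInfinity : (ℕ → ℕ) → Set
TendsToInfinity a = ∀ B → ∃ λ N → ∀ j → N ≤ j → B ≤ a j

-- A non-identity element g of S_m ≀ S_d moves some position: g sends the entry
-- (i′, a) of a tuple to the entry (i, j) ≠ (i′, a). Then g moves every tuple y with a ∈ y i′
-- and j ∉ y i, and when 2k ≤ m these make up at least a fraction k/2m of all n tuples
-- (C(m-1,k-1) C(m-1,k) / C(m,k)² if i′ ≠ i, C(m-2,k-1) / C(m,k) if i′ = i). G contains the even element acting as a 3-cycle on the first coordinate; it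
-- fixes every tuple whose first subset misses the three cycled points, so it moves at most
-- 3 C(m-1,k-1) C(m,k)^(d-1) = 3kn/m tuples.
-- Hence k/2m ≤ mindeg(G)/n ≤ 3k/m once m ≥ 3, and the two ratios tend to zero together.
module Submission where

open import Level using (0ℓ)
open import Function using (_∘_)
open import Function.Bundles using (_⇔_; mk⇔; Equivalence)
open import Data.Bool using (Bool; true; false; _∧_; _∨_; not; if_then_else_; T)
import Data.Bool.Properties as Boolₚ
open import Data.Maybe using (Maybe; just; nothing)
open import Data.Product using (_×_; _,_; ∃; proj₁; proj₂)
open import Data.Product.Properties using () renaming (≡-dec to ×-≡-dec)
open import Data.Sum using (_⊎_; inj₁; inj₂)
import Data.Sum as Sum
import Data.Nat as ℕ
open ℕ using (ℕ; zero; suc; _+_; _*_; _≤_; _<_; z≤n; s≤s; _^_)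
import Data.Nat.Properties as ℕₚ
open import Data.Nat.Divisibility using (divides)
open import Data.Nat.Combinatorics using (_C_; nCk+nC[k+1]≡[n+1]C[k+1]; nC1≡n)
open import Data.Nat.Tactic.RingSolver using (solve-∀)
open import Algebra.Properties.CommutativeSemigroup ℕₚ.*-commutativeSemigroup using (x∙yz≈y∙xz)
import Data.Integer as ℤ
import Data.Integer.Properties as ℤₚ
open import Data.Rational as ℚ using (mkℚ)
import Data.Rational.Properties as ℚₚ
open import Data.Rational.Unnormalised as ℚᵘ using (mkℚᵘ)
import Data.Rational.Unnormalised.Properties as ℚᵘₚ
open import Data.Fin using (Fin; zero; suc)
import Data.Fin as Fin
import Data.Fin.Properties as Finₚ
open import Data.Fin.Subset using (Subset; ∣_∣)
open import Data.Fin.Permutation using (Permutation′; _⟨$⟩ʳ_; _⟨$⟩ˡ_; permutation)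
import Data.Fin.Permutation as Perm
open import Data.List using (List; []; _∷_; _++_; length; filter; map; concatMap; cartesianProduct; allFin)
import Data.List as List
open import Data.Vec using (Vec; []; _∷_; lookup; replicate; tabulate; _[_]≔_)
open import Data.Vec.Properties
  using (lookup-replicate; lookup∘update; lookup∘update′; lookup∘tabulate; tabulate∘lookup; tabulate-cong)
import Data.Vec.Relation.Unary.All as All
open import Data.Vec.Functional using (updateAt)
open import Data.Vec.Functional.Properties using (updateAt-updates; updateAt-minimal)
open import Relation.Nullary using (¬_; does; Dec; yes; no; contradiction)
open import Relation.Nullary.Decidable using (decidable-stable; T?)
open import Relation.Unary using (Pred; Decidable; _∈_)
open import Relation.Binary.PropositionalEquality

open import Defs

¬T⇒≡false : ∀ {b} → ¬ T b → b ≡ false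
¬T⇒≡false {false} _  = refl
¬T⇒≡false {true}  ¬T = contradiction _ ¬T

module _ {A : Set} where

  does-sound : (a? : Dec A) → T (does a?) → A
  does-sound (yes a) _ = a

  not-does-sound : (a? : Dec A) → T (not (does a?)) → ¬ A
  not-does-sound (no ¬a) _ = ¬a

  not-does-complete : (a? : Dec A) → ¬ A → T (not (does a?))
  not-does-complete (yes a) ¬a = ¬a a
  not-does-complete (no _)  _  = _

  countᵇ : (A → Bool) → List A → ℕ
  countᵇ f []       = 0
  countᵇ f (x ∷ xs) = if f x then suc (countᵇ f xs) else countᵇ f xs

  length-filter≡countᵇ : ∀ {P : Pred A 0ℓ} (P? : Decidable P) xs →
    length (filter P? xs) ≡ countᵇ (does ∘ P?) xs
  length-filter≡countᵇ P? []       = refl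
  length-filter≡countᵇ P? (x ∷ xs) with does (P? x)
  ... | true  = cong suc (length-filter≡countᵇ P? xs)
  ... | false = length-filter≡countᵇ P? xs

  countᵇ-filter : ∀ {P : Pred A 0ℓ} (P? : Decidable P) f xs →
    countᵇ f (filter P? xs) ≡ countᵇ (λ x → does (P? x) ∧ f x) xs
  countᵇ-filter P? f []       = refl
  countᵇ-filter P? f (x ∷ xs) with does (P? x)
  ... | false = countᵇ-filter P? f xs
  ... | true with f x
  ...   | true  = cong suc (countᵇ-filter P? f xs)
  ...   | false = countᵇ-filter P? f xs

  countᵇ-mono : ∀ {f g} → (∀ x → T (f x) → T (g x)) → ∀ xs → countᵇ f xs ≤ countᵇ g xs
  countᵇ-mono         f⊆g []       = z≤n
  countᵇ-mono {f} {g} f⊆g (x ∷ xs) with f x | g x | f⊆g x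
  ... | true  | true  | _   = s≤s (countᵇ-mono f⊆g xs)
  ... | true  | false | f⇒g with () ← f⇒g _
  ... | false | true  | _   = ℕₚ.m≤n⇒m≤1+n (countᵇ-mono f⊆g xs)
  ... | false | false | _   = countᵇ-mono f⊆g xs

  countᵇ-cong : ∀ {f g} → (∀ x → f x ≡ g x) → ∀ xs → countᵇ f xs ≡ countᵇ g xs
  countᵇ-cong f≗g []       = refl
  countᵇ-cong f≗g (x ∷ xs) rewrite f≗g x | countᵇ-cong f≗g xs = refl

  countᵇ-none : ∀ {f} → (∀ x → f x ≡ false) → ∀ xs → countᵇ f xs ≡ 0
  countᵇ-none f≡false []       = refl
  countᵇ-none f≡false (x ∷ xs) rewrite f≡false x = countᵇ-none f≡false xs

  countᵇ-∨ : ∀ f g xs → countᵇ (λ x → f x ∨ g x) xs ≤ countᵇ f xs + countᵇ g xs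
  countᵇ-∨ f g []       = z≤n
  countᵇ-∨ f g (x ∷ xs) with f x | g x
  ... | true  | true  = s≤s (ℕₚ.≤-trans (countᵇ-∨ f g xs) (ℕₚ.+-monoʳ-≤ (countᵇ f xs) (ℕₚ.n≤1+n _)))
  ... | true  | false = s≤s (countᵇ-∨ f g xs)
  ... | false | true  = ℕₚ.≤-trans (s≤s (countᵇ-∨ f g xs)) (ℕₚ.≤-reflexive (sym (ℕₚ.+-suc _ _)))
  ... | false | false = countᵇ-∨ f g xs

  countᵇ-++ : ∀ f xs ys → countᵇ f (xs ++ ys) ≡ countᵇ f xs + countᵇ f ys
  countᵇ-++ f []       ys = refl
  countᵇ-++ f (x ∷ xs) ys with f x
  ... | true  = cong suc (countᵇ-++ f xs ys)
  ... | false = countᵇ-++ f xs ys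

  countᵇ>0⇒∃ : ∀ f xs → 0 < countᵇ f xs → ∃ λ x → T (f x)
  countᵇ>0⇒∃ f (x ∷ xs) 0<n with f x in fx
  ... | true  = x , subst T (sym fx) _
  ... | false = countᵇ>0⇒∃ f xs 0<n

module _ {A B : Set} where

  countᵇ-map : ∀ (f : B → Bool) (h : A → B) xs → countᵇ f (map h xs) ≡ countᵇ (f ∘ h) xs
  countᵇ-map f h []       = refl
  countᵇ-map f h (x ∷ xs) with f (h x)
  ... | true  = cong suc (countᵇ-map f h xs)
  ... | false = countᵇ-map f h xs

  countᵇ-concatMap-pair : ∀ (f : B → Bool) (g h : A → B) xs →
    countᵇ f (concatMap (λ x → g x ∷ h x ∷ []) xs) ≡ countᵇ (f ∘ g) xs + countᵇ (f ∘ h) xs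
  countᵇ-concatMap-pair f g h []       = refl
  countᵇ-concatMap-pair f g h (x ∷ xs) with f (g x) | f (h x)
  ... | true  | true  = cong suc (trans (cong suc (countᵇ-concatMap-pair f g h xs)) (sym (ℕₚ.+-suc _ _)))
  ... | true  | false = cong suc (countᵇ-concatMap-pair f g h xs)
  ... | false | true  = trans (cong suc (countᵇ-concatMap-pair f g h xs)) (sym (ℕₚ.+-suc _ _))
  ... | false | false = countᵇ-concatMap-pair f g h xs

countᵇ-concatMap-map : ∀ {A B C : Set} (F : C → Bool) (g : A → B → C) (p : A → Bool) (q : B → Bool) →
  (∀ x y → F (g x y) ≡ p x ∧ q y) →
  ∀ xs ys → countᵇ F (concatMap (λ x → map (g x) ys) xs) ≡ countᵇ p xs * countᵇ q ys
countᵇ-concatMap-map F g p q F≡p∧q []       ys = refl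
countᵇ-concatMap-map F g p q F≡p∧q (x ∷ xs) ys = begin
  countᵇ F (map (g x) ys ++ concatMap (λ x → map (g x) ys) xs)
    ≡⟨ countᵇ-++ F (map (g x) ys) _ ⟩
  countᵇ F (map (g x) ys) + countᵇ F (concatMap (λ x → map (g x) ys) xs)
    ≡⟨ cong₂ _+_ (trans (countᵇ-map F (g x) ys) (countᵇ-cong (F≡p∧q x) ys)) (countᵇ-concatMap-map F g p q F≡p∧q xs ys) ⟩
  countᵇ (λ y → p x ∧ q y) ys + countᵇ p xs * countᵇ q ys
    ≡⟨ row (p x) ⟩
  countᵇ p (x ∷ xs) * countᵇ q ys ∎
  where
  open ≡-Reasoning
  row : ∀ b → countᵇ (λ y → b ∧ q y) ys + countᵇ p xs * countᵇ q ys ≡ (if b then suc (countᵇ p xs) else countᵇ p xs) * countᵇ q ys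
  row true  = refl
  row false = cong (_+ countᵇ p xs * countᵇ q ys) (countᵇ-none (λ _ → refl) ys)

countᵇ-∧-false : ∀ {A : Set} (f : A → Bool) xs → countᵇ (λ x → f x ∧ false) xs ≡ 0
countᵇ-∧-false f = countᵇ-none (Boolₚ.∧-zeroʳ ∘ f)

countᵇ-tabulate-none : ∀ {A : Set} {n} (f : A → Bool) (h : Fin n → A) → (∀ i → f (h i) ≡ false) → countᵇ f (List.tabulate h) ≡ 0
countᵇ-tabulate-none {n = zero}  f h h∉f = refl
countᵇ-tabulate-none {n = suc n} f h h∉f rewrite h∉f zero = countᵇ-tabulate-none f (h ∘ suc) (h∉f ∘ suc)

countᵇ-cartesianProduct-∷ : ∀ {A B : Set} (F : A × B → Bool) x xs ys →
  countᵇ F (cartesianProduct (x ∷ xs) ys) ≡ countᵇ (λ y → F (x , y)) ys + countᵇ F (cartesianProduct xs ys)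
countᵇ-cartesianProduct-∷ F x xs ys = trans (countᵇ-++ F (map (x ,_) ys) _) (cong (_+ _) (countᵇ-map F (x ,_) ys))

countᵇ-cartesianProduct-tabulate-none : ∀ {A B : Set} {n} (F : A × B → Bool) (h : Fin n → A) ys →
  (∀ i y → F (h i , y) ≡ false) → countᵇ F (cartesianProduct (List.tabulate h) ys) ≡ 0
countᵇ-cartesianProduct-tabulate-none {n = zero}  F h ys none = refl
countᵇ-cartesianProduct-tabulate-none {n = suc n} F h ys none = trans (countᵇ-cartesianProduct-∷ F (h zero) (List.tabulate (h ∘ suc)) ys)
  (cong₂ _+_ (countᵇ-none (none zero) ys) (countᵇ-cartesianProduct-tabulate-none F (h ∘ suc) ys (none ∘ suc)))

-- A pattern pins position a inside (just true) or outside (just false) the subset, or leaves it free.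
Pattern : ℕ → Set
Pattern = Vec (Maybe Bool)

blank : ∀ {m} → Pattern m
blank = replicate _ nothing

agrees : Maybe Bool → Bool → Bool
agrees nothing      c = true
agrees (just true)  c = c
agrees (just false) c = not c

matches : ∀ {m} → Pattern m → Subset m → Bool
matches []       []       = true
matches (p ∷ ps) (c ∷ s) = agrees p c ∧ matches ps s

#in : ∀ {m} → Pattern m → ℕ
#in []              = 0
#in (just true ∷ p) = suc (#in p)
#in (_ ∷ p)         = #in p

#free : ∀ {m} → Pattern m → ℕ
#free []           = 0
#free (nothing ∷ p) = suc (#free p)
#free (just _ ∷ p)  = #free p

hasSize : ∀ {m} → ℕ → Subset m → Bool
hasSize k s = does (∣ s ∣ ℕ.≟ k)

fits : ∀ {m} → ℕ → Pattern m → Subset m → Bool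
fits k p s = hasSize k s ∧ matches p s

countᵇ-allSubsets-suc : ∀ m (f : Subset (suc m) → Bool) →
  countᵇ f (allSubsets (suc m)) ≡ countᵇ (f ∘ (true ∷_)) (allSubsets m) + countᵇ (f ∘ (false ∷_)) (allSubsets m)
countᵇ-allSubsets-suc m f = countᵇ-concatMap-pair f (true ∷_) (false ∷_) (allSubsets m)

count-fits-overfull : ∀ {m} k (p : Pattern m) → k < #in p → countᵇ (fits k p) (allSubsets m) ≡ 0
count-fits-overfull {suc m} k (nothing ∷ p) k<in = trans (countᵇ-allSubsets-suc m _)
  (cong₂ _+_ (with-first k k<in) (count-fits-overfull k p k<in))
  where
  with-first : ∀ k → k < #in p → countᵇ (λ s → fits k (nothing ∷ p) (true ∷ s)) (allSubsets m) ≡ 0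
  with-first zero    _    = countᵇ-none (λ _ → refl) (allSubsets m)
  with-first (suc k) k<in = count-fits-overfull k p (ℕₚ.<-trans (ℕₚ.n<1+n k) k<in)
count-fits-overfull {suc m} zero (just true ∷ p) _ = trans (countᵇ-allSubsets-suc m _)
  (cong₂ _+_ (countᵇ-none (λ _ → refl) (allSubsets m)) (countᵇ-∧-false (hasSize 0) (allSubsets m)))
count-fits-overfull {suc m} (suc k) (just true ∷ p) (s≤s k<in) = trans (countᵇ-allSubsets-suc m _)
  (cong₂ _+_ (count-fits-overfull k p k<in) (countᵇ-∧-false (hasSize (suc k)) (allSubsets m)))
count-fits-overfull {suc m} k (just false ∷ p) k<in = trans (countᵇ-allSubsets-suc m _)
  (cong₂ _+_ (countᵇ-∧-false (λ s → hasSize k (true ∷ s)) (allSubsets m)) (count-fits-overfull k p k<in))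

count-fits : ∀ {m} k r (p : Pattern m) → k ≡ #in p + r → countᵇ (fits k p) (allSubsets m) ≡ #free p C r
count-fits {zero}  k zero    []               refl = refl
count-fits {zero}  k (suc r) []               refl = refl
count-fits {suc m} k zero    (nothing ∷ p)    k≡ = trans (countᵇ-allSubsets-suc m _)
  (cong₂ _+_ (no-first k k≡) (count-fits k zero p k≡))
  where
  no-first : ∀ k → k ≡ #in p + 0 → countᵇ (λ s → fits k (nothing ∷ p) (true ∷ s)) (allSubsets m) ≡ 0
  no-first zero    _  = countᵇ-none (λ _ → refl) (allSubsets m)
  no-first (suc k) k≡ = count-fits-overfull k p
    (subst (k <_) (trans k≡ (ℕₚ.+-identityʳ (#in p))) (ℕₚ.n<1+n k))
count-fits {suc m} k (suc r) (nothing ∷ p) k≡ = begin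
  countᵇ (fits k (nothing ∷ p)) (allSubsets (suc m))       ≡⟨ countᵇ-allSubsets-suc m _ ⟩
  countᵇ (λ s → fits k (nothing ∷ p) (true ∷ s)) (allSubsets m) + countᵇ (fits k p) (allSubsets m)
    ≡⟨ cong₂ _+_ (with-first k k≡) (count-fits k (suc r) p k≡) ⟩
  #free p C r + #free p C suc r                             ≡⟨ nCk+nC[k+1]≡[n+1]C[k+1] (#free p) r ⟩
  suc (#free p) C suc r                                     ∎
  where
  open ≡-Reasoning
  with-first : ∀ k → k ≡ #in p + suc r → countᵇ (λ s → fits k (nothing ∷ p) (true ∷ s)) (allSubsets m) ≡ #free p C r
  with-first zero    0≡ = contradiction (trans 0≡ (ℕₚ.+-suc (#in p) r)) λ ()
  with-first (suc k) k≡ = count-fits k r p (ℕₚ.suc-injective (trans k≡ (ℕₚ.+-suc (#in p) r)))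
count-fits {suc m} (suc k) r (just true ∷ p) k≡ = trans (countᵇ-allSubsets-suc m _)
  (trans (cong₂ _+_ (count-fits k r p (ℕₚ.suc-injective k≡)) (countᵇ-∧-false (hasSize (suc k)) (allSubsets m)))
         (ℕₚ.+-identityʳ _))
count-fits {suc m} k r (just false ∷ p) k≡ = trans (countᵇ-allSubsets-suc m _)
  (cong₂ _+_ (countᵇ-∧-false (λ s → hasSize k (true ∷ s)) (allSubsets m)) (count-fits k r p k≡))

matches-blank : ∀ {m} (s : Subset m) → matches blank s ≡ true
matches-blank []      = refl
matches-blank (_ ∷ s) = matches-blank s

#in-blank : ∀ m → #in (blank {m}) ≡ 0
#in-blank zero    = refl
#in-blank (suc m) = #in-blank m

#free-blank : ∀ m → #free (blank {m}) ≡ m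
#free-blank zero    = refl
#free-blank (suc m) = cong suc (#free-blank m)

lookup-blank : ∀ {m} (a : Fin m) → lookup blank a ≡ nothing
lookup-blank a = lookup-replicate a nothing

#free-pin : ∀ {m} (p : Pattern m) a b → lookup p a ≡ nothing → suc (#free (p [ a ]≔ just b)) ≡ #free p
#free-pin (nothing ∷ p) zero    b refl = refl
#free-pin (nothing ∷ p) (suc a) b a∉p  = cong suc (#free-pin p a b a∉p)
#free-pin (just _ ∷ p)  (suc a) b a∉p  = #free-pin p a b a∉p

#in-pin-in : ∀ {m} (p : Pattern m) a → lookup p a ≡ nothing → #in (p [ a ]≔ just true) ≡ suc (#in p)
#in-pin-in (nothing ∷ p)    zero    refl = refl
#in-pin-in (nothing ∷ p)    (suc a) a∉p  = #in-pin-in p a a∉p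
#in-pin-in (just true ∷ p)  (suc a) a∉p  = cong suc (#in-pin-in p a a∉p)
#in-pin-in (just false ∷ p) (suc a) a∉p  = #in-pin-in p a a∉p

#in-pin-out : ∀ {m} (p : Pattern m) a → lookup p a ≡ nothing → #in (p [ a ]≔ just false) ≡ #in p
#in-pin-out (nothing ∷ p)    zero    refl = refl
#in-pin-out (nothing ∷ p)    (suc a) a∉p  = #in-pin-out p a a∉p
#in-pin-out (just true ∷ p)  (suc a) a∉p  = cong suc (#in-pin-out p a a∉p)
#in-pin-out (just false ∷ p) (suc a) a∉p  = #in-pin-out p a a∉p

agrees-just : ∀ b c → T (agrees (just b) c) → c ≡ b
agrees-just true  true  _ = refl
agrees-just false false _ = refl

matches-lookup : ∀ {m} (p : Pattern m) s a {b} → lookup p a ≡ just b → T (matches p s) → lookup s a ≡ b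
matches-lookup (x ∷ p) (c ∷ s) zero    refl s∈p = agrees-just _ c (proj₁ (Equivalence.to Boolₚ.T-∧ s∈p))
matches-lookup (x ∷ p) (c ∷ s) (suc a) a∈p  s∈p = matches-lookup p s a a∈p (proj₂ (Equivalence.to Boolₚ.T-∧ s∈p))

matches-blank-pin : ∀ {m} (s : Subset m) a → T (lookup s a) → T (matches (blank [ a ]≔ just true) s)
matches-blank-pin (true ∷ s)  zero    _   = subst T (sym (matches-blank s)) _
matches-blank-pin (c ∷ s)     (suc a) a∈s = matches-blank-pin s a a∈s

count-fits-blank : ∀ m k → countᵇ (fits k blank) (allSubsets m) ≡ m C k
count-fits-blank m k = trans (count-fits {m} k k blank (cong (_+ k) (sym (#in-blank m)))) (cong (_C k) (#free-blank m))

count-fits-in : ∀ n k (a : Fin (suc n)) → countᵇ (fits (suc k) (blank [ a ]≔ just true)) (allSubsets (suc n)) ≡ n C k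
count-fits-in n k a = trans
  (count-fits (suc k) k p (cong (_+ k) (sym (trans (#in-pin-in blank a (lookup-blank a)) (cong suc (#in-blank n))))))
  (cong (_C k) (ℕₚ.suc-injective (trans (#free-pin blank a true (lookup-blank a)) (#free-blank (suc n)))))
  where p = blank [ a ]≔ just true

count-fits-out : ∀ n k (j : Fin (suc n)) → countᵇ (fits k (blank [ j ]≔ just false)) (allSubsets (suc n)) ≡ n C k
count-fits-out n k j = trans
  (count-fits k k p (cong (_+ k) (sym (trans (#in-pin-out blank j (lookup-blank j)) (#in-blank (suc n))))))
  (cong (_C k) (ℕₚ.suc-injective (trans (#free-pin blank j false (lookup-blank j)) (#free-blank (suc n)))))
  where p = blank [ j ]≔ just false

count-fits-in-out : ∀ n k (a j : Fin (2 + n)) → a ≢ j →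
  countᵇ (fits (suc k) ((blank [ j ]≔ just false) [ a ]≔ just true)) (allSubsets (2 + n)) ≡ n C k
count-fits-in-out n k a j a≢j = trans (count-fits (suc k) k p₂ (cong (_+ k) (sym #in-p₂))) (cong (_C k) #free-p₂)
  where
  p₁ = blank [ j ]≔ just false
  p₂ = p₁ [ a ]≔ just true
  a∉p₁ : lookup p₁ a ≡ nothing
  a∉p₁ = trans (lookup∘update′ a≢j blank (just false)) (lookup-blank a)
  #in-p₂ : #in p₂ ≡ 1
  #in-p₂ = trans (#in-pin-in p₁ a a∉p₁) (cong suc (trans (#in-pin-out blank j (lookup-blank j)) (#in-blank (2 + n))))
  #free-p₂ : #free p₂ ≡ n
  #free-p₂ = ℕₚ.suc-injective (ℕₚ.suc-injective (trans (cong suc (#free-pin p₁ a true a∉p₁))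
    (trans (#free-pin blank j false (lookup-blank j)) (#free-blank (2 + n)))))

[k+1]*[n+1]C[k+1]≡[n+1]*nCk : ∀ n k → suc k * (suc n C suc k) ≡ suc n * (n C k)
[k+1]*[n+1]C[k+1]≡[n+1]*nCk zero    zero    = refl
[k+1]*[n+1]C[k+1]≡[n+1]*nCk zero    (suc k) = ℕₚ.*-zeroʳ (2 + k)
[k+1]*[n+1]C[k+1]≡[n+1]*nCk (suc n) zero    =
  trans (ℕₚ.*-identityˡ _) (trans (nC1≡n (2 + n)) (sym (ℕₚ.*-identityʳ _)))
[k+1]*[n+1]C[k+1]≡[n+1]*nCk (suc n) (suc k) = begin
  (2 + k) * ((2 + n) C (2 + k))               ≡⟨ cong ((2 + k) *_) (sym (pascal (suc n) (suc k))) ⟩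
  (2 + k) * (X + Y)                           ≡⟨ rearrange k X Y ⟩
  suc k * X + (2 + k) * Y + X                 ≡⟨ cong₂ (λ a b → a + b + X) (absorb n k) (absorb n (suc k)) ⟩
  suc n * (n C k) + suc n * (n C suc k) + X   ≡⟨ cong (_+ X) (sym (ℕₚ.*-distribˡ-+ (suc n) (n C k) (n C suc k))) ⟩
  suc n * (n C k + n C suc k) + X             ≡⟨ cong (λ z → suc n * z + X) (pascal n k) ⟩
  suc n * X + X                               ≡⟨ ℕₚ.+-comm (suc n * X) X ⟩
  (2 + n) * X                                 ∎
  where
  open ≡-Reasoning
  pascal = nCk+nC[k+1]≡[n+1]C[k+1]
  absorb = [k+1]*[n+1]C[k+1]≡[n+1]*nCk
  X = suc n C suc k
  Y = suc n C (2 + k)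
  rearrange : ∀ k X Y → (2 + k) * (X + Y) ≡ suc k * X + (2 + k) * Y + X
  rearrange = solve-∀

nCk≤nC[k+1] : ∀ n k → suc (2 * k) ≤ n → n C k ≤ n C suc k
nCk≤nC[k+1] n k 2k<n = ℕₚ.*-cancelˡ-≤ (suc k) (ℕₚ.+-cancelˡ-≤ (suc k * (n C k)) _ _ (begin
  suc k * (n C k) + suc k * (n C k)       ≡⟨ double k (n C k) ⟩
  (2 + 2 * k) * (n C k)                   ≤⟨ ℕₚ.*-monoˡ-≤ (n C k) (s≤s 2k<n) ⟩
  suc n * (n C k)                         ≡⟨ [k+1]*[n+1]C[k+1]≡[n+1]*nCk n k ⟨
  suc k * (suc n C suc k)                 ≡⟨ cong (suc k *_) (nCk+nC[k+1]≡[n+1]C[k+1] n k) ⟨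
  suc k * (n C k + n C suc k)             ≡⟨ ℕₚ.*-distribˡ-+ (suc k) (n C k) (n C suc k) ⟩
  suc k * (n C k) + suc k * (n C suc k)   ∎))
  where
  open ℕₚ.≤-Reasoning
  double : ∀ k c → suc k * c + suc k * c ≡ (2 + 2 * k) * c
  double = solve-∀

2k≤m⇒k≤m : ∀ {k m} → 2 * k ≤ m → k ≤ m
2k≤m⇒k≤m {k} = ℕₚ.≤-trans (ℕₚ.m≤m+n k (k + 0))

nCk>0 : ∀ n k → k ≤ n → 0 < n C k
nCk>0 n       zero    _         = s≤s z≤n
nCk>0 (suc n) (suc k) (s≤s k≤n) = ℕₚ.<-≤-trans (nCk>0 n k k≤n)
  (subst (n C k ≤_) (nCk+nC[k+1]≡[n+1]C[k+1] n k) (ℕₚ.m≤m+n _ _))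

[n+1]Ck≤2*nCk : ∀ n k → 2 * k ≤ suc n → suc n C k ≤ 2 * (n C k)
[n+1]Ck≤2*nCk n zero    _     = s≤s z≤n
[n+1]Ck≤2*nCk n (suc k) 2k≤n+1 = begin
  suc n C suc k              ≡⟨ nCk+nC[k+1]≡[n+1]C[k+1] n k ⟨
  n C k + n C suc k          ≤⟨ ℕₚ.+-monoˡ-≤ (n C suc k) (nCk≤nC[k+1] n k 2k<n) ⟩
  n C suc k + n C suc k      ≡⟨ cong (n C suc k +_) (ℕₚ.+-identityʳ _) ⟨
  2 * (n C suc k)            ∎
  where
  open ℕₚ.≤-Reasoning
  2k<n : suc (2 * k) ≤ n
  2k<n = ℕₚ.≤-pred (subst (_≤ suc n) (ℕₚ.*-suc 2 k) 2k≤n+1)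

-- C(m-2,k-1) / C(m,k) ≥ k / 2m  for 2k ≤ m
[k+1]*[n+2]C[k+1]≤2[n+2]*nCk : ∀ n k → 2 * suc k ≤ 2 + n → suc k * ((2 + n) C suc k) ≤ 2 * (2 + n) * (n C k)
[k+1]*[n+2]C[k+1]≤2[n+2]*nCk n k 2k+2≤n+2 = begin
  suc k * ((2 + n) C suc k)    ≡⟨ [k+1]*[n+1]C[k+1]≡[n+1]*nCk (suc n) k ⟩
  (2 + n) * (suc n C k)        ≤⟨ ℕₚ.*-monoʳ-≤ (2 + n) ([n+1]Ck≤2*nCk n k 2k≤n+1) ⟩
  (2 + n) * (2 * (n C k))      ≡⟨ reorder (2 + n) (n C k) ⟩
  2 * (2 + n) * (n C k)        ∎
  where
  open ℕₚ.≤-Reasoning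
  2k≤n+1 : 2 * k ≤ suc n
  2k≤n+1 = ℕₚ.m≤n⇒m≤1+n (ℕₚ.≤-pred (ℕₚ.≤-pred (subst (_≤ 2 + n) (ℕₚ.*-suc 2 k) 2k+2≤n+2)))
  reorder : ∀ m c → m * (2 * c) ≡ 2 * m * c
  reorder = solve-∀

-- C(m-1,k-1) C(m-1,k) / C(m,k)² ≥ k / 2m  for 2k ≤ m
[k+1]*[n+1]C[k+1]²≤2[n+1]*nCk*nC[k+1] : ∀ n k → 2 * suc k ≤ suc n →
  suc k * ((suc n C suc k) * (suc n C suc k)) ≤ 2 * suc n * ((n C k) * (n C suc k))
[k+1]*[n+1]C[k+1]²≤2[n+1]*nCk*nC[k+1] n k 2k+2≤n+1 = begin
  suc k * (X * X)                        ≡⟨ ℕₚ.*-assoc (suc k) X X ⟨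
  suc k * X * X                          ≡⟨ cong (_* X) ([k+1]*[n+1]C[k+1]≡[n+1]*nCk n k) ⟩
  suc n * (n C k) * X                    ≤⟨ ℕₚ.*-monoʳ-≤ (suc n * (n C k)) ([n+1]Ck≤2*nCk n (suc k) 2k+2≤n+1) ⟩
  suc n * (n C k) * (2 * (n C suc k))    ≡⟨ reorder (suc n) (n C k) (n C suc k) ⟩
  2 * suc n * ((n C k) * (n C suc k))    ∎
  where
  open ℕₚ.≤-Reasoning
  X = suc n C suc k
  reorder : ∀ m a b → m * a * (2 * b) ≡ 2 * m * (a * b)
  reorder = solve-∀

∏ : ∀ {d} → (Fin d → ℕ) → ℕ
∏ {zero}  f = 1
∏ {suc d} f = f zero * ∏ (f ∘ suc)

∏-cong : ∀ {d} {f g : Fin d → ℕ} → (∀ i → f i ≡ g i) → ∏ f ≡ ∏ g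
∏-cong {zero}  f≗g = refl
∏-cong {suc d} f≗g = cong₂ _*_ (f≗g zero) (∏-cong (f≗g ∘ suc))

∏-const : ∀ d c → ∏ {d} (λ _ → c) ≡ c ^ d
∏-const zero    c = refl
∏-const (suc d) c = cong (c *_) (∏-const d c)

∏-updateAt : ∀ {d} (f : Fin d → ℕ) i c → c * ∏ f ≡ f i * ∏ (updateAt f i (λ _ → c))
∏-updateAt {suc d} f zero    c = x∙yz≈y∙xz c (f zero) (∏ (f ∘ suc))
∏-updateAt {suc d} f (suc i) c = begin
  c * (f zero * ∏ (f ∘ suc))                     ≡⟨ x∙yz≈y∙xz c (f zero) _ ⟩
  f zero * (c * ∏ (f ∘ suc))                     ≡⟨ cong (f zero *_) (∏-updateAt (f ∘ suc) i c) ⟩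
  f zero * (f (suc i) * ∏ (updateAt (f ∘ suc) i (λ _ → c))) ≡⟨ x∙yz≈y∙xz (f zero) (f (suc i)) _ ⟩
  f (suc i) * (f zero * ∏ (updateAt (f ∘ suc) i (λ _ → c))) ∎
  where open ≡-Reasoning

∏-except : ∀ {d} (f : Fin d → ℕ) i c → (∀ l → l ≢ i → f l ≡ c) → c * ∏ f ≡ f i * c ^ d
∏-except {d} f i c f≡c = trans (∏-updateAt f i c) (cong (f i *_) (trans (∏-cong at) (∏-const d c)))
  where
  at : ∀ l → updateAt f i (λ _ → c) l ≡ c
  at l with l Finₚ.≟ i
  ... | yes refl = updateAt-updates l f
  ... | no  l≢i  = trans (updateAt-minimal l i f l≢i) (f≡c l l≢i)

∏-except₂ : ∀ {d} (f : Fin d → ℕ) i i′ c → i ≢ i′ → (∀ l → l ≢ i → l ≢ i′ → f l ≡ c) →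
  c * c * ∏ f ≡ f i * f i′ * c ^ d
∏-except₂ {d} f i i′ c i≢i′ f≡c = begin
  c * c * ∏ f                 ≡⟨ ℕₚ.*-assoc c c (∏ f) ⟩
  c * (c * ∏ f)               ≡⟨ cong (c *_) (∏-updateAt f i′ c) ⟩
  c * (f i′ * ∏ g)            ≡⟨ x∙yz≈y∙xz c (f i′) (∏ g) ⟩
  f i′ * (c * ∏ g)            ≡⟨ cong (f i′ *_) (∏-except g i c g≡c) ⟩
  f i′ * (g i * c ^ d)        ≡⟨ cong (λ x → f i′ * (x * c ^ d)) (updateAt-minimal i i′ f i≢i′) ⟩
  f i′ * (f i * c ^ d)        ≡⟨ x∙yz≈y∙xz (f i′) (f i) (c ^ d) ⟩
  f i * (f i′ * c ^ d)        ≡⟨ ℕₚ.*-assoc (f i) (f i′) (c ^ d) ⟨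
  f i * f i′ * c ^ d          ∎
  where
  open ≡-Reasoning
  g = updateAt f i′ (λ _ → c)
  g≡c : ∀ l → l ≢ i → g l ≡ c
  g≡c l l≢i with l Finₚ.≟ i′
  ... | yes refl = updateAt-updates l f
  ... | no  l≢i′ = trans (updateAt-minimal l i′ f l≢i′) (f≡c l l≢i l≢i′)

coordwise : ∀ {m d} → (Fin d → Subset m → Bool) → Tuple m d → Bool
coordwise P []      = true
coordwise P (s ∷ x) = P zero s ∧ coordwise (P ∘ suc) x

count-coordwise : ∀ m d (P : Fin d → Subset m → Bool) →
  countᵇ (coordwise P) (allTuples m d) ≡ ∏ (λ i → countᵇ (P i) (allSubsets m))
count-coordwise m zero    P = refl
count-coordwise m (suc d) P = trans
  (countᵇ-concatMap-map (coordwise P) _∷_ (P zero) (coordwise (P ∘ suc)) (λ _ _ → refl) (allSubsets m) (allTuples m d))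
  (cong (countᵇ (P zero) (allSubsets m) *_) (count-coordwise m d (P ∘ suc)))

coordwise-lookup : ∀ {m d} (P : Fin d → Subset m → Bool) x → T (coordwise P x) → ∀ i → T (P i (lookup x i))
coordwise-lookup P (s ∷ x) x∈P zero    = proj₁ (Equivalence.to Boolₚ.T-∧ x∈P)
coordwise-lookup P (s ∷ x) x∈P (suc i) = coordwise-lookup (P ∘ suc) x (proj₂ (Equivalence.to Boolₚ.T-∧ x∈P)) i

coordwise-mono : ∀ {m d} {P Q : Fin d → Subset m → Bool} → (∀ i s → T (P i s) → T (Q i s)) →
  ∀ x → T (coordwise P x) → T (coordwise Q x)
coordwise-mono P⊆Q []      _   = _
coordwise-mono P⊆Q (s ∷ x) x∈P = Equivalence.from Boolₚ.T-∧
  (P⊆Q zero s (proj₁ x∈P′) , coordwise-mono (P⊆Q ∘ suc) x (proj₂ x∈P′))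
  where x∈P′ = Equivalence.to Boolₚ.T-∧ x∈P

count-hasSize : ∀ m k → countᵇ (hasSize k) (allSubsets m) ≡ m C k
count-hasSize m k = trans (countᵇ-cong (λ s → sym (fits-blank s)) (allSubsets m)) (count-fits-blank m k)
  where
  fits-blank : ∀ s → fits k blank s ≡ hasSize k s
  fits-blank s = trans (cong (hasSize k s ∧_) (matches-blank s)) (Boolₚ.∧-identityʳ _)

isPoint : ∀ {m d} → ℕ → Tuple m d → Bool
isPoint k = coordwise (λ _ → hasSize k)

all?-hasSize≡isPoint : ∀ {m d} k (x : Tuple m d) → does (All.all? (λ s → ∣ s ∣ ℕ.≟ k) x) ≡ isPoint k x
all?-hasSize≡isPoint k []      = refl
all?-hasSize≡isPoint k (s ∷ x) = cong (hasSize k s ∧_) (all?-hasSize≡isPoint k x)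

∣Ω∣≡nCk^d : ∀ m k d → length (Ω m k d) ≡ (m C k) ^ d
∣Ω∣≡nCk^d m k d = begin
  length (Ω m k d)                                  ≡⟨ length-filter≡countᵇ _ (allTuples m d) ⟩
  countᵇ _ (allTuples m d)                          ≡⟨ countᵇ-cong (all?-hasSize≡isPoint k) (allTuples m d) ⟩
  countᵇ (isPoint k) (allTuples m d)                ≡⟨ count-coordwise m d _ ⟩
  ∏ {d} (λ _ → countᵇ (hasSize k) (allSubsets m))   ≡⟨ ∏-const d _ ⟩
  countᵇ (hasSize k) (allSubsets m) ^ d             ≡⟨ cong (_^ d) (count-hasSize m k) ⟩
  (m C k) ^ d                                       ∎
  where open ≡-Reasoning

movesᵇ : ∀ {m d} → ℕ → W m d → Tuple m d → Bool
movesᵇ k g x = isPoint k x ∧ not (does (act g x ≟T x))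

moved≡countᵇ : ∀ {m d} k (g : W m d) → moved k g ≡ countᵇ (movesᵇ k g) (allTuples m d)
moved≡countᵇ {m} {d} k g = begin
  moved k g                                  ≡⟨ length-filter≡countᵇ _ (Ω m k d) ⟩
  countᵇ _ (Ω m k d)                         ≡⟨ countᵇ-filter _ _ (allTuples m d) ⟩
  countᵇ _ (allTuples m d)                   ≡⟨ countᵇ-cong (λ x → cong (_∧ _) (all?-hasSize≡isPoint k x)) (allTuples m d) ⟩
  countᵇ (movesᵇ k g) (allTuples m d)        ∎
  where open ≡-Reasoning

moved>0⇒NonId : ∀ {m d} k (g : W m d) → 0 < moved k g → NonId k g
moved>0⇒NonId {m} {d} k g 0<moved with countᵇ>0⇒∃ (movesᵇ k g) (allTuples m d) (subst (0 <_) (moved≡countᵇ k g) 0<moved)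
... | x , x-moves = x , isPt , gx≢x
  where
  parts = Equivalence.to Boolₚ.T-∧ x-moves
  isPt : IsPt k x
  isPt = does-sound (All.all? (λ s → ∣ s ∣ ℕ.≟ k) x) (subst T (sym (all?-hasSize≡isPoint k x)) (proj₁ parts))
  gx≢x : act g x ≢ x
  gx≢x = not-does-sound (act g x ≟T x) (proj₂ parts)

coordwise⇒moved≥∏ : ∀ {m d} k (g : W m d) (P : Fin d → Subset m → Bool) →
  (∀ y → T (coordwise P y) → T (movesᵇ k g y)) → ∏ (λ l → countᵇ (P l) (allSubsets m)) ≤ moved k g
coordwise⇒moved≥∏ {m} {d} k g P P⊆moves = subst₂ _≤_ (count-coordwise m d P) (sym (moved≡countᵇ k g))
  (countᵇ-mono P⊆moves (allTuples m d))

-- Every non-identity element moves at least k/2m of the points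

entry : ∀ {m d} → Tuple m d → Fin d × Fin m → Bool
entry y (i , j) = lookup (lookup y i) j

preimage : ∀ {m d} → W m d → Fin d × Fin m → Fin d × Fin m
preimage (σ , π) (i , j) = π ⟨$⟩ˡ i , σ i ⟨$⟩ˡ j

entry-act : ∀ {m d} (g : W m d) y p → entry (act g y) p ≡ entry y (preimage g p)
entry-act (σ , π) y (i , j) =
  trans (cong (λ s → lookup s j) (lookup∘tabulate _ i)) (lookup∘tabulate _ j)

fixes-positions⇒fixes : ∀ {m d} (g : W m d) → (∀ p → preimage g p ≡ p) → ∀ y → act g y ≡ y
fixes-positions⇒fixes (σ , π) fixed y = begin
  tabulate (λ i → tabulate (λ j → entry y (preimage (σ , π) (i , j))))  ≡⟨ tabulate-cong (λ i → tabulate-cong (λ j → cong (entry y) (fixed (i , j)))) ⟩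
  tabulate (λ i → tabulate (lookup (lookup y i)))                       ≡⟨ tabulate-cong (λ i → tabulate∘lookup (lookup y i)) ⟩
  tabulate (lookup y)                                                   ≡⟨ tabulate∘lookup y ⟩
  y                                                                     ∎
  where open ≡-Reasoning

NonId⇒displaces : ∀ {m d} k (g : W m d) → NonId k g → ∃ λ p → preimage g p ≢ p
NonId⇒displaces {m} {d} k g (x , _ , gx≢x) =
  let i , row-moves = Finₚ.¬∀⟶∃¬ d _ (λ i → Finₚ.all? (λ j → fixed? (i , j))) not-all-fixed
      j , displaced = Finₚ.¬∀⟶∃¬ m _ (λ j → fixed? (i , j)) row-moves
  in (i , j) , displaced
  where
  fixed? : ∀ p → Dec (preimage g p ≡ p)
  fixed? p = ×-≡-dec Finₚ._≟_ Finₚ._≟_ (preimage g p) p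
  not-all-fixed : ¬ (∀ i j → preimage g (i , j) ≡ (i , j))
  not-all-fixed fixed = gx≢x (fixes-positions⇒fixes g (λ (i , j) → fixed i j) x)

-- the coordinatewise pattern of the tuples y with a ∈ y i′ and j ∉ y i
inOut : ∀ {m d} → Fin d × Fin m → Fin d × Fin m → Fin d → Pattern m
inOut (i′ , a) (i , j) = updateAt (updateAt (λ _ → blank) i (_[ j ]≔ just false)) i′ (_[ a ]≔ just true)

module _ {m d} (i′ : Fin d) (a : Fin m) (i : Fin d) (j : Fin m) where

  private
    out = updateAt (λ _ → blank) i (_[ j ]≔ just false)

  inOut-elsewhere : ∀ l → l ≢ i′ → l ≢ i → inOut (i′ , a) (i , j) l ≡ blank
  inOut-elsewhere l l≢i′ l≢i = trans (updateAt-minimal l i′ out l≢i′) (updateAt-minimal l i _ l≢i)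

  inOut-in : i′ ≢ i → inOut (i′ , a) (i , j) i′ ≡ blank [ a ]≔ just true
  inOut-in i′≢i = trans (updateAt-updates i′ out) (cong (_[ a ]≔ just true) (updateAt-minimal i′ i _ i′≢i))

  inOut-out : i ≢ i′ → inOut (i′ , a) (i , j) i ≡ blank [ j ]≔ just false
  inOut-out i≢i′ = trans (updateAt-minimal i i′ out i≢i′) (updateAt-updates i _)

inOut-same : ∀ {m d} (i : Fin d) (a j : Fin m) → inOut (i , a) (i , j) i ≡ (blank [ j ]≔ just false) [ a ]≔ just true
inOut-same i a j = trans (updateAt-updates i _) (cong (_[ a ]≔ just true) (updateAt-updates i _))

inOut-entry-in : ∀ {m d} (i′ : Fin d) (a : Fin m) p → lookup (inOut (i′ , a) p i′) a ≡ just true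
inOut-entry-in i′ a (i , j) = trans (cong (λ v → lookup v a) (updateAt-updates i′ out)) (lookup∘update a (out i′) (just true))
  where out = updateAt (λ _ → blank) i (_[ j ]≔ just false)

inOut-entry-out : ∀ {m d} (i′ : Fin d) (a : Fin m) i j → (i′ , a) ≢ (i , j) → lookup (inOut (i′ , a) (i , j) i) j ≡ just false
inOut-entry-out i′ a i j q≢p with i Finₚ.≟ i′
... | no  i≢i′ = trans (cong (λ v → lookup v j) (inOut-out i′ a i j i≢i′)) (lookup∘update j blank (just false))
... | yes refl = begin
  lookup (inOut (i , a) (i , j) i) j                          ≡⟨ cong (λ v → lookup v j) (inOut-same i a j) ⟩
  lookup ((blank [ j ]≔ just false) [ a ]≔ just true) j      ≡⟨ lookup∘update′ (λ j≡a → q≢p (cong (i ,_) (sym j≡a))) (blank [ j ]≔ just false) (just true) ⟩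
  lookup (blank [ j ]≔ just false) j                          ≡⟨ lookup∘update j blank (just false) ⟩
  just false                                                  ∎
  where open ≡-Reasoning

inOut-moves : ∀ {m d} k (g : W m d) q p → preimage g p ≡ q → q ≢ p →
  ∀ y → T (coordwise (λ l → fits k (inOut q p l)) y) → T (movesᵇ k g y)
inOut-moves k g _ p@(i , j) refl displaced y y∈inOut =
  Equivalence.from Boolₚ.T-∧ (isPt , not-does-complete (act g y ≟T y) gy≢y)
  where
  i′ = proj₁ (preimage g p)
  a  = proj₂ (preimage g p)
  fits-at : ∀ l → T (fits k (inOut (preimage g p) p l) (lookup y l))
  fits-at = coordwise-lookup _ y y∈inOut
  isPt : T (isPoint k y)
  isPt = coordwise-mono (λ _ _ → proj₁ ∘ Equivalence.to Boolₚ.T-∧) y y∈inOut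
  a∈yi′ : entry y (preimage g p) ≡ true
  a∈yi′ = matches-lookup (inOut (preimage g p) p i′) (lookup y i′) a (inOut-entry-in i′ a p) (proj₂ (Equivalence.to Boolₚ.T-∧ (fits-at i′)))
  j∉yi : entry y p ≡ false
  j∉yi = matches-lookup (inOut (preimage g p) p i) (lookup y i) j (inOut-entry-out i′ a i j displaced) (proj₂ (Equivalence.to Boolₚ.T-∧ (fits-at i)))
  gy≢y : act g y ≢ y
  gy≢y gy≡y = Boolₚ.not-¬ refl (begin
    true                           ≡⟨ a∈yi′ ⟨
    entry y (preimage g p)         ≡⟨ entry-act g y p ⟨
    entry (act g y) p              ≡⟨ cong (λ z → entry z p) gy≡y ⟩
    entry y p                      ≡⟨ j∉yi ⟩
    false                          ∎)
    where open ≡-Reasoning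

bound-by-proportion : ∀ {N D} k c M x E → 0 < c → k * c ≤ M * x → c * N ≡ x * E → N ≤ D → k * E ≤ M * D
bound-by-proportion {N} {D} k c M x E 0<c kc≤Mx cN≡xE N≤D = ℕₚ.*-cancelʳ-≤ (k * E) (M * D) c ⦃ ℕ.>-nonZero 0<c ⦄ (begin
  k * E * c        ≡⟨ reorder k E c ⟩
  k * c * E        ≤⟨ ℕₚ.*-monoˡ-≤ E kc≤Mx ⟩
  M * x * E        ≡⟨ ℕₚ.*-assoc M x E ⟩
  M * (x * E)      ≡⟨ cong (M *_) cN≡xE ⟨
  M * (c * N)      ≤⟨ ℕₚ.*-monoʳ-≤ M (ℕₚ.*-monoʳ-≤ c N≤D) ⟩
  M * (c * D)      ≡⟨ ℕₚ.*-assoc M c D ⟨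
  M * c * D        ≡⟨ reorder M c D ⟩
  M * D * c        ∎)
  where
  open ℕₚ.≤-Reasoning
  reorder : ∀ a b c → a * b * c ≡ a * c * b
  reorder = solve-∀

inOut-counts : ∀ {m d} → ℕ → Fin d × Fin m → Fin d × Fin m → Fin d → ℕ
inOut-counts {m} k q p l = countᵇ (fits k (inOut q p l)) (allSubsets m)

count-fits-cong : ∀ {m} k {p p′ : Pattern m} → p ≡ p′ → countᵇ (fits k p) (allSubsets m) ≡ countᵇ (fits k p′) (allSubsets m)
count-fits-cong {m} k = cong (λ p → countᵇ (fits k p) (allSubsets m))

∏-inOut-apart : ∀ n t d (i′ : Fin d) (a : Fin (suc n)) i j → i′ ≢ i →
  let c = suc n C suc t in c * c * ∏ (inOut-counts (suc t) (i′ , a) (i , j)) ≡ (n C t) * (n C suc t) * c ^ d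
∏-inOut-apart n t d i′ a i j i′≢i =
  trans (∏-except₂ (inOut-counts (suc t) (i′ , a) (i , j)) i′ i (suc n C suc t) i′≢i elsewhere)
        (cong₂ (λ x y → x * y * (suc n C suc t) ^ d) in′ out)
  where
  elsewhere : ∀ l → l ≢ i′ → l ≢ i → inOut-counts (suc t) (i′ , a) (i , j) l ≡ suc n C suc t
  elsewhere l l≢i′ l≢i = trans (count-fits-cong (suc t) (inOut-elsewhere i′ a i j l l≢i′ l≢i)) (count-fits-blank (suc n) (suc t))
  in′ : inOut-counts (suc t) (i′ , a) (i , j) i′ ≡ n C t
  in′ = trans (count-fits-cong (suc t) (inOut-in i′ a i j i′≢i)) (count-fits-in n t a)
  out : inOut-counts (suc t) (i′ , a) (i , j) i ≡ n C suc t
  out = trans (count-fits-cong (suc t) (inOut-out i′ a i j (i′≢i ∘ sym))) (count-fits-out n (suc t) j)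

∏-inOut-same : ∀ n t d (i : Fin d) (a j : Fin (2 + n)) → a ≢ j →
  let c = (2 + n) C suc t in c * ∏ (inOut-counts (suc t) (i , a) (i , j)) ≡ (n C t) * c ^ d
∏-inOut-same n t d i a j a≢j =
  trans (∏-except (inOut-counts (suc t) (i , a) (i , j)) i ((2 + n) C suc t) elsewhere)
        (cong (_* ((2 + n) C suc t) ^ d) same)
  where
  elsewhere : ∀ l → l ≢ i → inOut-counts (suc t) (i , a) (i , j) l ≡ (2 + n) C suc t
  elsewhere l l≢i = trans (count-fits-cong (suc t) (inOut-elsewhere i a i j l l≢i l≢i)) (count-fits-blank (2 + n) (suc t))
  same : inOut-counts (suc t) (i , a) (i , j) i ≡ n C t
  same = trans (count-fits-cong (suc t) (inOut-same i a j)) (count-fits-in-out n t a j a≢j)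

moved≥∏inOut : ∀ {m d} k (g : W m d) q p → preimage g p ≡ q → q ≢ p → ∏ (inOut-counts k q p) ≤ moved k g
moved≥∏inOut k g q p g⁻¹p≡q q≢p = coordwise⇒moved≥∏ k g (λ l → fits k (inOut q p l)) (inOut-moves k g q p g⁻¹p≡q q≢p)

moved-lower-bound-at : ∀ n t d (g : W (2 + n) d) q p → preimage g p ≡ q → q ≢ p → 2 * suc t ≤ 2 + n →
  suc t * ((2 + n) C suc t) ^ d ≤ 2 * (2 + n) * moved (suc t) g
moved-lower-bound-at n t d g q@(i′ , a) p@(i , j) g⁻¹p≡q q≢p 2k≤m with i′ Finₚ.≟ i
... | no i′≢i = bound-by-proportion (suc t) (c * c) (2 * (2 + n)) ((suc n C t) * (suc n C suc t)) (c ^ d)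
  (ℕₚ.*-mono-< c>0 c>0) binomial product (moved≥∏inOut (suc t) g q p g⁻¹p≡q q≢p)
  where
  c = (2 + n) C suc t
  c>0 = nCk>0 (2 + n) (suc t) (2k≤m⇒k≤m 2k≤m)
  binomial : suc t * (c * c) ≤ 2 * (2 + n) * ((suc n C t) * (suc n C suc t))
  binomial = [k+1]*[n+1]C[k+1]²≤2[n+1]*nCk*nC[k+1] (suc n) t 2k≤m
  product : c * c * ∏ (inOut-counts (suc t) q p) ≡ (suc n C t) * (suc n C suc t) * c ^ d
  product = ∏-inOut-apart (suc n) t d i′ a i j i′≢i
... | yes refl = bound-by-proportion (suc t) c (2 * (2 + n)) (n C t) (c ^ d)
  c>0 binomial product (moved≥∏inOut (suc t) g q p g⁻¹p≡q q≢p)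
  where
  c = (2 + n) C suc t
  c>0 = nCk>0 (2 + n) (suc t) (2k≤m⇒k≤m 2k≤m)
  binomial : suc t * c ≤ 2 * (2 + n) * (n C t)
  binomial = [k+1]*[n+2]C[k+1]≤2[n+2]*nCk n t 2k≤m
  product : c * ∏ (inOut-counts (suc t) q p) ≡ (n C t) * c ^ d
  product = ∏-inOut-same n t d i a j (q≢p ∘ cong (i ,_))

moved-lower-bound : ∀ n t d (g : W (2 + n) d) → 2 * suc t ≤ 2 + n → NonId (suc t) g →
  suc t * ((2 + n) C suc t) ^ d ≤ 2 * (2 + n) * moved (suc t) g
moved-lower-bound n t d g 2k≤m nonId =
  let p , displaced = NonId⇒displaces (suc t) g nonId
  in moved-lower-bound-at n t d g (preimage g p) p refl displaced 2k≤m

-- An even element moving at most 3k/m of the points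

isInversion : ∀ {m} → Permutation′ m → Fin m × Fin m → Bool
isInversion σ (i , j) = does (i Fin.<? j) ∧ does ((σ ⟨$⟩ʳ j) Fin.<? (σ ⟨$⟩ʳ i))

inversions≡countᵇ : ∀ {m} (σ : Permutation′ m) → inversions σ ≡ countᵇ (isInversion σ) (cartesianProduct (allFin m) (allFin m))
inversions≡countᵇ {m} σ = trans (length-filter≡countᵇ _ (filter _ pairs)) (countᵇ-filter _ _ pairs)
  where pairs = cartesianProduct (allFin m) (allFin m)

<-asymᵇ : ∀ {m} (i j : Fin m) → does (i Fin.<? j) ∧ does (j Fin.<? i) ≡ false
<-asymᵇ i j = ¬T⇒≡false λ both →
  let i<j , j<i = Equivalence.to Boolₚ.T-∧ both
  in Finₚ.<-asym (does-sound (i Fin.<? j) i<j) (does-sound (j Fin.<? i) j<i)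

id-isEven : ∀ m → IsEven (Perm.id {m})
id-isEven m = divides 0 (trans (inversions≡countᵇ (Perm.id {m}))
  (countᵇ-none (λ (i , j) → <-asymᵇ i j) (cartesianProduct (allFin m) (allFin m))))

rotate : ∀ {n} → Fin (3 + n) → Fin (3 + n)
rotate zero                = suc zero
rotate (suc zero)          = suc (suc zero)
rotate (suc (suc zero))    = zero
rotate (suc (suc (suc i))) = suc (suc (suc i))

rotate⁻¹ : ∀ {n} → Fin (3 + n) → Fin (3 + n)
rotate⁻¹ zero                = suc (suc zero)
rotate⁻¹ (suc zero)          = zero
rotate⁻¹ (suc (suc zero))    = suc zero
rotate⁻¹ (suc (suc (suc i))) = suc (suc (suc i))

rotate∘rotate⁻¹ : ∀ {n} (i : Fin (3 + n)) → rotate (rotate⁻¹ i) ≡ i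
rotate∘rotate⁻¹ zero                = refl
rotate∘rotate⁻¹ (suc zero)          = refl
rotate∘rotate⁻¹ (suc (suc zero))    = refl
rotate∘rotate⁻¹ (suc (suc (suc i))) = refl

rotate⁻¹∘rotate : ∀ {n} (i : Fin (3 + n)) → rotate⁻¹ (rotate i) ≡ i
rotate⁻¹∘rotate zero                = refl
rotate⁻¹∘rotate (suc zero)          = refl
rotate⁻¹∘rotate (suc (suc zero))    = refl
rotate⁻¹∘rotate (suc (suc (suc i))) = refl

3-cycle : ∀ n → Permutation′ (3 + n)
3-cycle n = permutation rotate rotate⁻¹ rotate∘rotate⁻¹ rotate⁻¹∘rotate

-- the inversions of the 3-cycle are (0,2) and (1,2)
3-cycle-isEven : ∀ n → IsEven (3-cycle n)
3-cycle-isEven n = divides 1 (begin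
  inversions (3-cycle n)                                            ≡⟨ inversions≡countᵇ (3-cycle n) ⟩
  countᵇ inv (cartesianProduct all all)                             ≡⟨ countᵇ-cartesianProduct-∷ inv zero from₁ all ⟩
  row zero + countᵇ inv (cartesianProduct from₁ all)                ≡⟨ cong (row zero +_) (countᵇ-cartesianProduct-∷ inv (suc zero) from₂ all) ⟩
  row zero + (row (suc zero) + countᵇ inv (cartesianProduct from₂ all))
    ≡⟨ cong (λ r → row zero + (row (suc zero) + r)) (countᵇ-cartesianProduct-∷ inv (suc (suc zero)) from₃ all) ⟩
  row zero + (row (suc zero) + rest)
    ≡⟨ cong₂ (λ r₀ r₁ → r₀ + (r₁ + rest)) row₀ row₁ ⟩
  2 + rest                                                          ≡⟨ cong (2 +_) (cong₂ _+_ row₂ (countᵇ-cartesianProduct-tabulate-none inv _ all late-row)) ⟩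
  2                                                                 ∎)
  where
  open ≡-Reasoning
  all = allFin (3 + n)
  from₁ from₂ from₃ : List (Fin (3 + n))
  from₁ = List.tabulate {n = 2 + n} suc
  from₂ = List.tabulate {n = 1 + n} (λ i → suc (suc i))
  from₃ = List.tabulate {n = n} (λ i → suc (suc (suc i)))
  inv = isInversion (3-cycle n)
  row : Fin (3 + n) → ℕ
  row i = countᵇ (λ j → inv (i , j)) all
  rest = row (suc (suc zero)) + countᵇ inv (cartesianProduct from₃ all)
  row₀ : row zero ≡ 1
  row₀ = cong suc (countᵇ-tabulate-none (λ j → inv (zero , j)) (λ i → suc (suc (suc i))) (λ _ → refl))
  row₁ : row (suc zero) ≡ 1
  row₁ = cong suc (countᵇ-tabulate-none (λ j → inv (suc zero , j)) (λ i → suc (suc (suc i))) (λ _ → refl))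
  row₂ : row (suc (suc zero)) ≡ 0
  row₂ = countᵇ-tabulate-none (λ j → inv (suc (suc zero) , j)) (λ i → suc (suc (suc i))) (λ _ → refl)
  late-row : ∀ i j → inv (suc (suc (suc i)) , j) ≡ false
  late-row i zero                = refl
  late-row i (suc zero)          = refl
  late-row i (suc (suc zero))    = refl
  late-row i (suc (suc (suc j))) = <-asymᵇ (suc (suc (suc i))) (suc (suc (suc j)))

cycleFirst : ∀ n d → Fin (suc d) → Permutation′ (3 + n)
cycleFirst n d zero    = 3-cycle n
cycleFirst n d (suc _) = Perm.id

cycleFirst-isEven : ∀ n d i → IsEven (cycleFirst n d i)
cycleFirst-isEven n d zero    = 3-cycle-isEven n
cycleFirst-isEven n d (suc _) = id-isEven (3 + n)

g₃ : ∀ n d → W (3 + n) (suc d)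
g₃ n d = cycleFirst n d , Perm.id

meets₃ : ∀ {n} → Subset (3 + n) → Bool
meets₃ s = lookup s zero ∨ (lookup s (suc zero) ∨ lookup s (suc (suc zero)))

g₃-fixes : ∀ n d (y : Tuple (3 + n) (suc d)) → ¬ T (meets₃ (lookup y zero)) → act (g₃ n d) y ≡ y
g₃-fixes n d ((false ∷ false ∷ false ∷ s) ∷ y) _ = cong₂ _∷_
  (cong (λ t → false ∷ false ∷ false ∷ t) (tabulate∘lookup s))
  (trans (tabulate-cong (tabulate∘lookup ∘ lookup y)) (tabulate∘lookup y))
g₃-fixes n d ((true  ∷ _     ∷ _     ∷ _) ∷ y) avoids = contradiction _ avoids
g₃-fixes n d ((false ∷ true  ∷ _     ∷ _) ∷ y) avoids = contradiction _ avoids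
g₃-fixes n d ((false ∷ false ∷ true  ∷ _) ∷ y) avoids = contradiction _ avoids

moved≤∏ : ∀ {m d} k (g : W m d) (P : Fin d → Subset m → Bool) →
  (∀ y → T (movesᵇ k g y) → T (coordwise P y)) → moved k g ≤ ∏ (λ l → countᵇ (P l) (allSubsets m))
moved≤∏ {m} {d} k g P moves⊆P = subst₂ _≤_ (sym (moved≡countᵇ k g)) (count-coordwise m d P)
  (countᵇ-mono moves⊆P (allTuples m d))

fits-pin : ∀ {m} k (s : Subset m) a → T (hasSize k s) → T (lookup s a) → T (fits k (blank [ a ]≔ just true) s)
fits-pin k s a size a∈s = Equivalence.from Boolₚ.T-∧ (size , matches-blank-pin s a a∈s)

count-meets₃ : ∀ n t → countᵇ (λ s → hasSize (suc t) s ∧ meets₃ s) (allSubsets (3 + n)) ≤ 3 * ((2 + n) C t)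
count-meets₃ n t = begin
  countᵇ (λ s → hasSize k s ∧ meets₃ s) all                  ≤⟨ countᵇ-mono meets⇒fits all ⟩
  countᵇ (λ s → F₀ s ∨ (F₁ s ∨ F₂ s)) all                     ≤⟨ countᵇ-∨ F₀ _ all ⟩
  countᵇ F₀ all + countᵇ (λ s → F₁ s ∨ F₂ s) all              ≤⟨ ℕₚ.+-monoʳ-≤ (countᵇ F₀ all) (countᵇ-∨ F₁ F₂ all) ⟩
  countᵇ F₀ all + (countᵇ F₁ all + countᵇ F₂ all)             ≡⟨ cong₂ _+_ (count-fits-in (2 + n) t zero) (cong₂ _+_ (count-fits-in (2 + n) t (suc zero)) (count-fits-in (2 + n) t (suc (suc zero)))) ⟩
  X + (X + X)                                                 ≡⟨ cong (λ x → X + (X + x)) (ℕₚ.+-identityʳ X) ⟨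
  3 * X                                                       ∎
  where
  open ℕₚ.≤-Reasoning
  k = suc t
  X = (2 + n) C t
  all = allSubsets (3 + n)
  F₀ F₁ F₂ : Subset (3 + n) → Bool
  F₀ = fits k (blank [ zero ]≔ just true)
  F₁ = fits k (blank [ suc zero ]≔ just true)
  F₂ = fits k (blank [ suc (suc zero) ]≔ just true)
  meets⇒fits : ∀ s → T (hasSize k s ∧ meets₃ s) → T (F₀ s ∨ (F₁ s ∨ F₂ s))
  meets⇒fits s size∧meets with Equivalence.to Boolₚ.T-∧ size∧meets
  ... | size , meets with Equivalence.to Boolₚ.T-∨ meets
  ... | inj₁ 0∈s = Equivalence.from (Boolₚ.T-∨ {F₀ s}) (inj₁ (fits-pin k s zero size 0∈s))
  ... | inj₂ 1∨2 = Equivalence.from (Boolₚ.T-∨ {F₀ s}) (inj₂ (Equivalence.from (Boolₚ.T-∨ {F₁ s}) (case-split (Equivalence.to Boolₚ.T-∨ 1∨2))))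
    where
    case-split : T (lookup s (suc zero)) ⊎ T (lookup s (suc (suc zero))) → T (F₁ s) ⊎ T (F₂ s)
    case-split = Sum.map (fits-pin k s (suc zero) size) (fits-pin k s (suc (suc zero)) size)

moved-g₃ : ∀ n t d → moved (suc t) (g₃ n d) * (3 + n) ≤ 3 * suc t * ((3 + n) C suc t) ^ suc d
moved-g₃ n t d = begin
  moved k g * m                                  ≤⟨ ℕₚ.*-monoˡ-≤ m (moved≤∏ k g P moves⇒P) ⟩
  f₀ * ∏ {d} (λ _ → countᵇ (hasSize k) all) * m  ≡⟨ cong (λ x → f₀ * x * m) (trans (∏-const d _) (cong (_^ d) (count-hasSize m k))) ⟩
  f₀ * c ^ d * m                                 ≤⟨ ℕₚ.*-monoˡ-≤ m (ℕₚ.*-monoˡ-≤ (c ^ d) (count-meets₃ n t)) ⟩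
  3 * X * c ^ d * m                              ≡⟨ reorder₁ X (c ^ d) m ⟩
  3 * (m * X) * c ^ d                            ≡⟨ cong (λ x → 3 * x * c ^ d) ([k+1]*[n+1]C[k+1]≡[n+1]*nCk (2 + n) t) ⟨
  3 * (k * c) * c ^ d                            ≡⟨ reorder₂ k c (c ^ d) ⟩
  3 * k * c ^ suc d                              ∎
  where
  open ℕₚ.≤-Reasoning
  m = 3 + n
  k = suc t
  g = g₃ n d
  c = m C k
  X = (2 + n) C t
  all = allSubsets m
  P : Fin (suc d) → Subset m → Bool
  P zero    s = hasSize k s ∧ meets₃ s
  P (suc _) s = hasSize k s
  f₀ = countᵇ (P zero) all
  moves⇒P : ∀ y → T (movesᵇ k g y) → T (coordwise P y)
  moves⇒P y@(s ∷ y′) pt∧moves = Equivalence.from (Boolₚ.T-∧ {P zero s}) (Equivalence.from (Boolₚ.T-∧ {hasSize k s}) (size , meets) , rest)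
    where
    parts = Equivalence.to Boolₚ.T-∧ pt∧moves
    size = proj₁ (Equivalence.to Boolₚ.T-∧ (proj₁ parts))
    rest = proj₂ (Equivalence.to Boolₚ.T-∧ (proj₁ parts))
    meets : T (meets₃ s)
    meets = decidable-stable (T? (meets₃ s)) λ avoids → not-does-sound (act g y ≟T y) (proj₂ parts) (g₃-fixes n d y avoids)
  reorder₁ : ∀ X p m → 3 * X * p * m ≡ 3 * (m * X) * p
  reorder₁ = solve-∀
  reorder₂ : ∀ k c p → 3 * (k * c) * p ≡ 3 * k * (c * p)
  reorder₂ = solve-∀

g₃-NonId : ∀ n t d → 2 * suc t ≤ 3 + n → NonId (suc t) (g₃ n d)
g₃-NonId n t d 2k≤m = moved>0⇒NonId (suc t) (g₃ n d) (ℕₚ.*-cancelˡ-< (2 * (3 + n)) 0 _ (begin-strict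
  2 * (3 + n) * 0                                ≡⟨ ℕₚ.*-zeroʳ (2 * (3 + n)) ⟩
  0                                              <⟨ ℕₚ.m^n>0 ((3 + n) C suc t) ⦃ ℕ.>-nonZero c>0 ⦄ (suc d) ⟩
  ((3 + n) C suc t) ^ suc d                      ≤⟨ ℕₚ.m≤n*m _ (suc t) ⟩
  suc t * ((3 + n) C suc t) ^ suc d              ≤⟨ moved-lower-bound-at (suc n) t (suc d) (g₃ n d) (zero , zero) (zero , suc zero) refl (λ ()) 2k≤m ⟩
  2 * (3 + n) * moved (suc t) (g₃ n d)           ∎))
  where
  open ℕₚ.≤-Reasoning
  c>0 = nCk>0 (3 + n) (suc t) (2k≤m⇒k≤m 2k≤m)

Eventually : (ℕ → Set) → Set
Eventually P = ∃ λ N → ∀ j → N ≤ j → P j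

eventually-∧ : ∀ {P Q : ℕ → Set} → Eventually P → Eventually Q → Eventually (λ j → P j × Q j)
eventually-∧ (N , P-from) (M , Q-from) =
  N ℕ.⊔ M , λ j N⊔M≤j → P-from j (ℕₚ.≤-trans (ℕₚ.m≤m⊔n N M) N⊔M≤j) , Q-from j (ℕₚ.≤-trans (ℕₚ.m≤n⊔m N M) N⊔M≤j)

-- `a / b < 1 / (q + 1)`, with the convention a / 0 = 0 of `ratio`
Small : ℕ → ℕ → ℕ → Set
Small q a b = b ≡ 0 ⊎ a * suc q < b

ratio<ratio⇔ : ∀ a b c e → ratio a (suc b) ℚ.< ratio c (suc e) ⇔ a * suc e < c * suc b
ratio<ratio⇔ a b c e = mk⇔ to from
  where
  +a*+b≡+[a*b] : ∀ a b → ℤ.+ a ℤ.* ℤ.+ b ≡ ℤ.+ (a * b)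
  +a*+b≡+[a*b] a b = ℤₚ.+◃n≡+n (a * b)
  to : ratio a (suc b) ℚ.< ratio c (suc e) → a * suc e < c * suc b
  to r<r with ℚᵘₚ.<-respʳ-≃ (ℚₚ.toℚᵘ-fromℚᵘ (mkℚᵘ (ℤ.+ c) e)) (ℚᵘₚ.<-respˡ-≃ (ℚₚ.toℚᵘ-fromℚᵘ (mkℚᵘ (ℤ.+ a) b)) (ℚₚ.toℚᵘ-mono-< r<r))
  ... | ℚᵘ.*<* ae<cb with subst₂ ℤ._<_ (+a*+b≡+[a*b] a (suc e)) (+a*+b≡+[a*b] c (suc b)) ae<cb
  ...   | ℤ.+<+ ae<cb′ = ae<cb′
  from : a * suc e < c * suc b → ratio a (suc b) ℚ.< ratio c (suc e)
  from ae<cb = ℚₚ.toℚᵘ-cancel-<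
    (ℚᵘₚ.<-respʳ-≃ (ℚᵘₚ.≃-sym (ℚₚ.toℚᵘ-fromℚᵘ (mkℚᵘ (ℤ.+ c) e)))
      (ℚᵘₚ.<-respˡ-≃ (ℚᵘₚ.≃-sym (ℚₚ.toℚᵘ-fromℚᵘ (mkℚᵘ (ℤ.+ a) b)))
        (ℚᵘ.*<* (subst₂ ℤ._<_ (sym (+a*+b≡+[a*b] a (suc e))) (sym (+a*+b≡+[a*b] c (suc b))) (ℤ.+<+ ae<cb)))))

∣ratio∣≡ratio : ∀ a b → ℚ.∣ ratio a b ∣ ≡ ratio a b
∣ratio∣≡ratio a zero    = refl
∣ratio∣≡ratio a (suc b) = ℚₚ.0≤p⇒∣p∣≡p (ℚₚ.nonNegative⁻¹ (ratio a (suc b)) ⦃ ℚₚ.normalize-nonNeg a (suc b) ⦄)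

TendsToZero-ratio⇔ : ∀ (a b : ℕ → ℕ) → TendsToZero (λ j → ratio (a j) (b j)) ⇔ (∀ q → Eventually (λ j → Small q (a j) (b j)))
TendsToZero-ratio⇔ a b = mk⇔ to from
  where
  to : TendsToZero (λ j → ratio (a j) (b j)) → ∀ q → Eventually (λ j → Small q (a j) (b j))
  to ratio→0 q with ratio→0 (ratio 1 (suc q)) (Equivalence.from (ratio<ratio⇔ 0 0 1 q) (s≤s z≤n))
  ... | N , small = N , small′
    where
    small′ : ∀ j → N ≤ j → Small q (a j) (b j)
    small′ j N≤j with b j | small j N≤j
    ... | zero  | _ = inj₁ refl
    ... | suc b′ | r<1/q = inj₂ (subst (a j * suc q <_) (ℕₚ.+-identityʳ (suc b′))
      (Equivalence.to (ratio<ratio⇔ (a j) b′ 1 q) (subst (ℚ._< ratio 1 (suc q)) (∣ratio∣≡ratio (a j) (suc b′)) r<1/q)))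
  from : (∀ q → Eventually (λ j → Small q (a j) (b j))) → TendsToZero (λ j → ratio (a j) (b j))
  from small ε@(mkℚ (ℤ.+ suc p) q _) 0<ε = N , small′
    where
    N = proj₁ (small q)
    small′ : ∀ j → N ≤ j → ℚ.∣ ratio (a j) (b j) ∣ ℚ.< ε
    small′ j N≤j with b j | proj₂ (small q) j N≤j
    ... | zero   | _              = 0<ε
    ... | suc b′ | inj₂ aq<b     = subst₂ ℚ._<_ (sym (∣ratio∣≡ratio (a j) (suc b′))) (ℚₚ.fromℚᵘ-toℚᵘ ε)
      (Equivalence.from (ratio<ratio⇔ (a j) b′ (suc p) q) (ℕₚ.<-≤-trans aq<b (ℕₚ.m≤n*m (suc b′) (suc p))))
  from small (mkℚ (ℤ.+ zero)   _ _) (ℚ.*<* (ℤ.+<+ ()))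
  from small (mkℚ ℤ.-[1+ _ ] _ _) (ℚ.*<* ())

small-transfer : ∀ {a b} c {e} K q → Small (K * suc q) a b → 0 < b → c * b ≤ K * a * e → Small q c e
small-transfer c {zero} K q _ _ _ = inj₁ refl
small-transfer {b = zero} c K q _ () _
small-transfer {a} {b@(suc _)} c {suc e′} K q (inj₂ aK<b) _ cb≤Kae =
  inj₂ (ℕₚ.*-cancelʳ-< b (c * suc q) (suc e′) (begin-strict
    c * suc q * b          ≡⟨ reorder₁ c (suc q) b ⟩
    c * b * suc q          ≤⟨ ℕₚ.*-monoˡ-≤ (suc q) cb≤Kae ⟩
    K * a * suc e′ * suc q ≡⟨ reorder₂ K a (suc e′) (suc q) ⟩
    suc e′ * (a * (K * suc q)) <⟨ ℕₚ.*-monoʳ-< (suc e′) (ℕₚ.≤-<-trans (ℕₚ.*-monoʳ-≤ a (ℕₚ.n≤1+n _)) aK<b) ⟩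
    suc e′ * b             ∎))
  where
  open ℕₚ.≤-Reasoning
  reorder₁ : ∀ c q b → c * q * b ≡ c * b * q
  reorder₁ = solve-∀
  reorder₂ : ∀ K a e q → K * a * e * q ≡ e * (a * (K * q))
  reorder₂ = solve-∀

ratio→0-transfer : ∀ (a b c e : ℕ → ℕ) K → TendsToZero (λ j → ratio (a j) (b j)) →
  Eventually (λ j → 0 < b j × c j * b j ≤ K * a j * e j) → TendsToZero (λ j → ratio (c j) (e j))
ratio→0-transfer a b c e K a/b→0 bound = Equivalence.from (TendsToZero-ratio⇔ c e) λ q →
  let N , small-and-bound = eventually-∧ (Equivalence.to (TendsToZero-ratio⇔ a b) a/b→0 (K * suc q)) bound
  in N , λ j N≤j → let small , 0<b , cb≤Kae = small-and-bound j N≤j in small-transfer (c j) K q small 0<b cb≤Kae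

IsMinDeg⇒≤moved : ∀ {m k d G D} → IsMinDeg m k d G D → ∀ {g} → g ∈ G → NonId k g → D ≤ moved k g
IsMinDeg⇒≤moved (inj₁ (_ , _ , _ , _ , minimal)) g∈G nonId = minimal _ g∈G nonId
IsMinDeg⇒≤moved (inj₂ (trivial , _))             g∈G nonId = contradiction nonId (trivial _ g∈G)

mindeg-lower-bound : ∀ m k d (G : Pred (W m d) 0ℓ) D → 1 ≤ k → 2 * k ≤ m → IsMinDeg m k d G D →
  k * (m C k) ^ d ≤ 2 * D * m
mindeg-lower-bound m k d G D _ 2k≤m (inj₂ (_ , D≡∣Ω∣)) rewrite D≡∣Ω∣ | ∣Ω∣≡nCk^d m k d = begin
  k * (m C k) ^ d                 ≤⟨ ℕₚ.*-monoˡ-≤ ((m C k) ^ d) (ℕₚ.≤-trans (2k≤m⇒k≤m {k} 2k≤m) (ℕₚ.m≤n*m m 2)) ⟩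
  2 * m * (m C k) ^ d             ≡⟨ reorder m ((m C k) ^ d) ⟩
  2 * (m C k) ^ d * m             ∎
  where
  open ℕₚ.≤-Reasoning
  reorder : ∀ m p → 2 * m * p ≡ 2 * p * m
  reorder = solve-∀
mindeg-lower-bound (suc (suc n)) (suc t) d G D _ 2k≤m (inj₁ (g , _ , nonId , moved≡D , _)) =
  subst (suc t * ((2 + n) C suc t) ^ d ≤_) (trans (cong (2 * (2 + n) *_) moved≡D) (reorder (2 + n) D))
    (moved-lower-bound n t d g 2k≤m nonId)
  where
  reorder : ∀ m D → 2 * m * D ≡ 2 * D * m
  reorder = solve-∀
mindeg-lower-bound zero          (suc t) d G D _ ()           (inj₁ _)
mindeg-lower-bound (suc zero)    (suc t) d G D _ (s≤s 2t+1≤0) (inj₁ _) =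
  contradiction (subst (_≤ 0) (ℕₚ.+-suc t (t + 0)) 2t+1≤0) λ ()

mindeg-upper-bound : ∀ m k d (G : Pred (W m d) 0ℓ) D → IsCameron m k d G →
  1 ≤ k → 1 ≤ d → 2 * k ≤ m → 3 ≤ m → IsMinDeg m k d G D → D * m ≤ 3 * k * (m C k) ^ d
mindeg-upper-bound (suc (suc (suc n))) (suc t) (suc d) G D (_ , evens∈G , _) _ _ 2k≤m _ mindeg =
  ℕₚ.≤-trans (ℕₚ.*-monoˡ-≤ (3 + n) (IsMinDeg⇒≤moved mindeg g₃∈G (g₃-NonId n t d 2k≤m))) (moved-g₃ n t d)
  where g₃∈G = evens∈G (cycleFirst n d) (cycleFirst-isEven n d)
mindeg-upper-bound (suc zero)       _ _ _ _ _ _ _ _ (s≤s ())       _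
mindeg-upper-bound (suc (suc zero)) _ _ _ _ _ _ _ _ (s≤s (s≤s ())) _

lemma2p27 : (m k d : ℕ → ℕ) (G : (j : ℕ) → Pred (W (m j) (d j)) 0ℓ) (D : ℕ → ℕ) →
    (∀ j → IsCameron (m j) (k j) (d j) (G j)) →
    (∀ j → 1 ≤ k j) → (∀ j → 1 ≤ d j) → (∀ j → 2 * k j ≤ m j) →
    TendsToInfinity m →
    (∀ j → IsMinDeg (m j) (k j) (d j) (G j) (D j)) →
    (TendsToZero (λ j → ratio (D j) ((m j C k j) ^ d j))
      ⇔ TendsToZero (λ j → ratio (k j) (m j)))
lemma2p27 m k d G D cameron k≥1 d≥1 2k≤m m→∞ mindeg = mk⇔
  (λ D/n→0 → ratio→0-transfer D n k m 2 D/n→0 (0 , λ j _ → n>0 j , lower j))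
  (λ k/m→0 → ratio→0-transfer k m D n 3 k/m→0 (proj₁ (m→∞ 3) , λ j N≤j → upper j (proj₂ (m→∞ 3) j N≤j)))
  where
  n : ℕ → ℕ
  n j = (m j C k j) ^ d j
  n>0 : ∀ j → 0 < n j
  n>0 j = ℕₚ.m^n>0 (m j C k j) ⦃ ℕ.>-nonZero (nCk>0 (m j) (k j) (2k≤m⇒k≤m (2k≤m j))) ⦄ (d j)
  lower : ∀ j → k j * n j ≤ 2 * D j * m j
  lower j = mindeg-lower-bound (m j) (k j) (d j) (G j) (D j) (k≥1 j) (2k≤m j) (mindeg j)
  upper : ∀ j → 3 ≤ m j → 0 < m j × D j * m j ≤ 3 * k j * n j
  upper j 3≤m = ℕₚ.<-≤-trans (s≤s z≤n) 3≤m ,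
    mindeg-upper-bound (m j) (k j) (d j) (G j) (D j) (cameron j) (k≥1 j) (d≥1 j) (2k≤m j) 3≤m (mindeg j)
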